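{- Let $G=(V,E)$ be an undirected graph with positive edge weights and $T\subseteq V$ a terminal set. If two extreme sets $X$ and $Y$ cross and $X\cup Y$ is a Steiner cut, then $X\cup Y$ is extreme.
   Context: For $X\subseteq V$, $d(X)$ is the total weight of edges with exactly one endpoint in $X$. A Steiner cut is a set $X\subseteq V$ with $X\cap T\neq\emptyset$ and $T\not\subseteq X$. A Steiner cut $X$ is extreme if every Steiner cut $Y\subsetneq X$ satisfies $d(Y)>d(X)$. Two sets $X,Y$ cross if $X\cap Y$, $X\setminus Y$ and $Y\setminus X$ are all nonempty.
   Formalization: The edge weights are positive rationals. -}

module Defs where

open import Data.Nat using (ℕ)
open import Data.Bool using (Bool; true; false)
open import Data.Fin using (Fin)
open import Data.Fin.Subset using (Subset; inside; outside; _∈_; _∉_; _⊆_; _⊂_; _∩_; _∪_; _─_; Nonempty)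
open import Data.Vec using (lookup)
open import Data.Vec.Functional using (foldr)
open import Data.Rational using (ℚ; 0ℚ; _+_; _*_; _≤_; _<_)
open import Data.Product using (_×_)
open import Relation.Binary.PropositionalEquality using (_≡_)
open import Relation.Nullary using (¬_)

-- The edges are the pairs {i,j} with w i j > 0 (so every edge has positive
-- weight); parallel edges are merged by summing their weights.
record WGraph (n : ℕ) : Set where
  field
    w        : Fin n → Fin n → ℚ
    w-sym    : ∀ i j → w i j ≡ w j i
    w-nonneg : ∀ i j → 0ℚ ≤ w i j
    w-noloop : ∀ i → w i i ≡ 0ℚ

Σ : ∀ {n} → (Fin n → ℚ) → ℚ
Σ f = foldr _+_ 0ℚ f

𝟙 : Bool → ℚ
𝟙 true  = Data.Rational.1ℚ
𝟙 false = 0ℚ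

not : Bool → Bool
not true = false
not false = true

-- d(X): total weight of edges with exactly one endpoint in X,
-- i.e. the sum of w i j over ordered pairs (i , j) with i ∈ X and j ∉ X
-- (each such edge is counted exactly once).
d : ∀ {n} → WGraph n → Subset n → ℚ
d G X = Σ λ i → Σ λ j → 𝟙 (lookup X i) * (𝟙 (not (lookup X j)) * WGraph.w G i j)

SteinerCut : ∀ {n} → Subset n → Subset n → Set
SteinerCut T X = Nonempty (X ∩ T) × ¬ (T ⊆ X)

Extreme : ∀ {n} → WGraph n → Subset n → Subset n → Set
Extreme G T X = SteinerCut T X × (∀ Y → Y ⊂ X → SteinerCut T Y → d G X < d G Y)

Cross : ∀ {n} → Subset n → Subset n → Set
Cross X Y = Nonempty (X ∩ Y) × Nonempty (X ─ Y) × Nonempty (Y ─ X)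

module Submission where

-- The cut function d is submodular, d (A ∩ B) + d (A ∪ B) ≤ d A + d B, and
-- posimodular, d (A ─ B) + d (B ─ A) ≤ d A + d B; both hold edge by edge.
-- If the crossing extreme sets X and Y shared no terminal, X ─ Y and Y ─ X
-- would be proper Steiner subcuts of X and Y, so d X + d Y < d (X ─ Y) + d (Y ─ X),
-- contradicting posimodularity. So some terminal t lies in X ∩ Y.
-- Now let Z ⊊ X ∪ Y be a Steiner cut, with a terminal in Z ∩ X say. For an
-- extreme set A with Z ∩ A ∩ T ≠ ∅ and A ⊈ Z, the set Z ∩ A is a proper Steiner
-- subcut of A, so d A < d (Z ∩ A), and submodularity gives d (Z ∪ A) < d Z.
-- Absorbing first X and then Y (via t) into Z gives d (X ∪ Y) < d Z, the
-- inequality being strict because Z ≠ X ∪ Y means one absorption is proper.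

open import Data.Nat using (ℕ; zero; suc)
open import Data.Bool using (Bool; true; false; _∧_; _∨_)
open import Data.Bool.Properties using (∧-zeroʳ; ∧-identityʳ)
open import Data.Fin using (Fin; zero; suc)
open import Data.Fin.Subset using (Subset; inside; outside; _∈_; _∉_; _⊆_; _⊂_; _∩_; _∪_; _─_; Nonempty)
open import Data.Fin.Subset.Properties
  using (nonempty?; ⊆-antisym; ∩-comm; ∪-comm; p∩q⊆q; x∈p∩q⁺; x∈p∩q⁻; x∈p∪q⁻;
         p⊆p∪q; q⊆p∪q; x∈p∧x∉q⇒x∈p─q; _∈?_; p─q⊆p; p∩q≢∅⇒p─q⊂p)
open import Data.Vec using (_∷_; lookup; there)
open import Data.Vec.Properties using (lookup-zipWith)
open import Data.Rational using (ℚ; 0ℚ; _+_; _*_; _≤_; _<_)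
open import Data.Rational.Base using (nonNegative)
open import Data.Rational.Properties
  using (+-0-commutativeMonoid; ≤-refl; <-irrefl; <-≤-trans; ≤-<-trans; <⇒≤; +-comm;
         +-mono-≤; +-mono-<; +-mono-<-≤; _<?_; ≮⇒≥; *-assoc; *-identityˡ; *-zeroˡ; *-distribʳ-+;
         *-monoʳ-≤-nonNeg; _≤?_; ≤-reflexive)
open import Algebra.Properties.CommutativeMonoid.Sum +-0-commutativeMonoid using (∑-distrib-+; ∑-comm; sum-cong-≗)
open import Data.Product using (_×_; _,_; proj₁; proj₂)
open import Data.Sum using (inj₁; inj₂; [_,_])
open import Data.Empty using (⊥-elim)
open import Relation.Binary.PropositionalEquality using (_≡_; refl; sym; trans; cong; cong₂; subst; subst₂)
open import Relation.Nullary using (¬_; yes; no)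
open import Relation.Nullary.Decidable using (True; toWitness)
open import Data.Unit using (tt)
open import Defs

lookup-─ : ∀ {n} (p q : Subset n) i → lookup (p ─ q) i ≡ lookup p i ∧ not (lookup q i)
lookup-─ (x ∷ p) (inside  ∷ q) zero    = sym (∧-zeroʳ x)
lookup-─ (x ∷ p) (outside ∷ q) zero    = sym (∧-identityʳ x)
lookup-─ (x ∷ p) (inside  ∷ q) (suc i) = lookup-─ p q i
lookup-─ (x ∷ p) (outside ∷ q) (suc i) = lookup-─ p q i

∈-∩³ : ∀ {n} {p q r : Subset n} {x} → x ∈ p → x ∈ q → x ∈ r → x ∈ (p ∩ q) ∩ r
∈-∩³ x∈p x∈q x∈r = x∈p∩q⁺ (x∈p∩q⁺ (x∈p , x∈q) , x∈r)

∈-∩³⁻ : ∀ {n} {p q r : Subset n} {x} → x ∈ (p ∩ q) ∩ r → x ∈ p × x ∈ q × x ∈ r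
∈-∩³⁻ {p = p} {q} {r} x∈p∩q∩r =
  let x∈p∩q , x∈r = x∈p∩q⁻ (p ∩ q) r x∈p∩q∩r ; x∈p , x∈q = x∈p∩q⁻ p q x∈p∩q in x∈p , x∈q , x∈r

∪-least : ∀ {n} {p q r : Subset n} → p ⊆ r → q ⊆ r → p ∪ q ⊆ r
∪-least {p = p} {q} p⊆r q⊆r x∈p∪q = [ p⊆r , q⊆r ] (x∈p∪q⁻ p q x∈p∪q)

x∈p─q⇒x∉q : ∀ {n} (p q : Subset n) {x} → x ∈ p ─ q → x ∉ q
x∈p─q⇒x∉q (_ ∷ p) (inside  ∷ q) (there x∈p─q) (there x∈q) = x∈p─q⇒x∉q p q x∈p─q x∈q
x∈p─q⇒x∉q (_ ∷ p) (outside ∷ q) (there x∈p─q) (there x∈q) = x∈p─q⇒x∉q p q x∈p─q x∈q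

p─q≡∅⇒p⊆q : ∀ {n} {p q : Subset n} → ¬ Nonempty (p ─ q) → p ⊆ q
p─q≡∅⇒p⊆q {q = q} p─q≡∅ {x} x∈p with x ∈? q
... | yes x∈q = x∈q
... | no  x∉q = ⊥-elim (p─q≡∅ (x , x∈p∧x∉q⇒x∈p─q x∈p x∉q))

Σ-mono-≤ : ∀ {n} {f g : Fin n → ℚ} → (∀ i → f i ≤ g i) → Σ f ≤ Σ g
Σ-mono-≤ {zero}  f≤g = ≤-refl
Σ-mono-≤ {suc n} f≤g = +-mono-≤ (f≤g zero) (Σ-mono-≤ (λ i → f≤g (suc i)))

Σ² : ∀ {n} → (Fin n → Fin n → ℚ) → ℚ
Σ² f = Σ λ i → Σ λ j → f i j

Σ²-+ : ∀ {n} (f g : Fin n → Fin n → ℚ) → Σ² (λ i j → f i j + g i j) ≡ Σ² f + Σ² g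
Σ²-+ f g = trans (sum-cong-≗ (λ i → ∑-distrib-+ (f i) (g i))) (∑-distrib-+ (λ i → Σ (f i)) (λ i → Σ (g i)))

Σ²-+-mono-≤ : ∀ {n} {f g h k : Fin n → Fin n → ℚ} →
  (∀ i j → h i j + k i j ≤ f i j + g i j) → Σ² h + Σ² k ≤ Σ² f + Σ² g
Σ²-+-mono-≤ {f = f} {g} {h} {k} pointwise =
  subst₂ _≤_ (Σ²-+ h k) (Σ²-+ f g) (Σ-mono-≤ (λ i → Σ-mono-≤ (pointwise i)))

+-≤-cancel-< : ∀ {a b c u : ℚ} → a < c → c + u ≤ b + a → u < b
+-≤-cancel-< {a} {b} {c} {u} a<c c+u≤b+a with u <? b
... | yes u<b = u<b
... | no u≮b  = ⊥-elim (<-irrefl refl (<-≤-trans (+-mono-<-≤ a<c (≮⇒≥ u≮b))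
                                               (subst (c + u ≤_) (+-comm b a) c+u≤b+a)))

cutTerm : Bool → Bool → ℚ → ℚ
cutTerm a b w = 𝟙 a * (𝟙 (not b) * w)

𝟙-∧ : ∀ a b → 𝟙 (a ∧ b) ≡ 𝟙 a * 𝟙 b
𝟙-∧ true  b = sym (*-identityˡ (𝟙 b))
𝟙-∧ false b = sym (*-zeroˡ (𝟙 b))

cutTerm-𝟙 : ∀ a b w → cutTerm a b w ≡ 𝟙 (a ∧ not b) * w
cutTerm-𝟙 a b w = trans (sym (*-assoc (𝟙 a) _ w)) (cong (_* w) (sym (𝟙-∧ a (not b))))

-- On closed Booleans the coefficient inequality is decided by evaluation.
CoefficientsDominated : (a b c e f g h k : Bool) → Set
CoefficientsDominated a b c e f g h k =
  True (𝟙 (f ∧ not g) + 𝟙 (h ∧ not k) ≤? 𝟙 (a ∧ not b) + 𝟙 (c ∧ not e))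

cutTerm-+-mono-≤ : ∀ a b c e f g h k {w} → 0ℚ ≤ w → CoefficientsDominated a b c e f g h k →
  cutTerm f g w + cutTerm h k w ≤ cutTerm a b w + cutTerm c e w
cutTerm-+-mono-≤ a b c e f g h k {w} 0≤w dominated =
  subst₂ _≤_ (sym (cong₂ _+_ (cutTerm-𝟙 f g w) (cutTerm-𝟙 h k w)))
             (sym (cong₂ _+_ (cutTerm-𝟙 a b w) (cutTerm-𝟙 c e w)))
    (subst₂ _≤_ (*-distribʳ-+ w (𝟙 (f ∧ not g)) (𝟙 (h ∧ not k))) (*-distribʳ-+ w (𝟙 (a ∧ not b)) (𝟙 (c ∧ not e)))
      (*-monoʳ-≤-nonNeg w {{nonNegative 0≤w}} (toWitness dominated)))

submodular-coefficients : ∀ a b c e →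
  CoefficientsDominated a b c e (a ∧ c) (b ∧ e) (a ∨ c) (b ∨ e)
submodular-coefficients true  true  true  true  = tt
submodular-coefficients true  true  true  false = tt
submodular-coefficients true  true  false true  = tt
submodular-coefficients true  true  false false = tt
submodular-coefficients true  false true  true  = tt
submodular-coefficients true  false true  false = tt
submodular-coefficients true  false false true  = tt
submodular-coefficients true  false false false = tt
submodular-coefficients false true  true  true  = tt
submodular-coefficients false true  true  false = tt
submodular-coefficients false true  false true  = tt
submodular-coefficients false true  false false = tt
submodular-coefficients false false true  true  = tt
submodular-coefficients false false true  false = tt
submodular-coefficients false false false true  = tt
submodular-coefficients false false false false = tt

-- The second pair is read backwards, j → i, matching d written via w-sym.
posimodular-coefficients : ∀ a b c e →
  CoefficientsDominated a b e c (a ∧ not c) (b ∧ not e) (e ∧ not b) (c ∧ not a)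
posimodular-coefficients true  true  true  true  = tt
posimodular-coefficients true  true  true  false = tt
posimodular-coefficients true  true  false true  = tt
posimodular-coefficients true  true  false false = tt
posimodular-coefficients true  false true  true  = tt
posimodular-coefficients true  false true  false = tt
posimodular-coefficients true  false false true  = tt
posimodular-coefficients true  false false false = tt
posimodular-coefficients false true  true  true  = tt
posimodular-coefficients false true  true  false = tt
posimodular-coefficients false true  false true  = tt
posimodular-coefficients false true  false false = tt
posimodular-coefficients false false true  true  = tt
posimodular-coefficients false false true  false = tt
posimodular-coefficients false false false true  = tt
posimodular-coefficients false false false false = tt

cutTerm-submodular : ∀ a b c e {w} → 0ℚ ≤ w →
  cutTerm (a ∧ c) (b ∧ e) w + cutTerm (a ∨ c) (b ∨ e) w ≤ cutTerm a b w + cutTerm c e w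
cutTerm-submodular a b c e 0≤w =
  cutTerm-+-mono-≤ a b c e (a ∧ c) (b ∧ e) (a ∨ c) (b ∨ e) 0≤w (submodular-coefficients a b c e)

cutTerm-posimodular : ∀ a b c e {w} → 0ℚ ≤ w →
  cutTerm (a ∧ not c) (b ∧ not e) w + cutTerm (e ∧ not b) (c ∧ not a) w ≤ cutTerm a b w + cutTerm e c w
cutTerm-posimodular a b c e 0≤w =
  cutTerm-+-mono-≤ a b e c (a ∧ not c) (b ∧ not e) (e ∧ not b) (c ∧ not a) 0≤w (posimodular-coefficients a b c e)

module _ {n} (G : WGraph n) where
  open WGraph G

  d-submodular : ∀ A B → d G (A ∩ B) + d G (A ∪ B) ≤ d G A + d G B
  d-submodular A B = Σ²-+-mono-≤ pointwise
    where
    pointwise : ∀ i j →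
      cutTerm (lookup (A ∩ B) i) (lookup (A ∩ B) j) (w i j) + cutTerm (lookup (A ∪ B) i) (lookup (A ∪ B) j) (w i j)
        ≤ cutTerm (lookup A i) (lookup A j) (w i j) + cutTerm (lookup B i) (lookup B j) (w i j)
    pointwise i j
      rewrite lookup-zipWith _∧_ i A B | lookup-zipWith _∧_ j A B
            | lookup-zipWith _∨_ i A B | lookup-zipWith _∨_ j A B =
      cutTerm-submodular (lookup A i) (lookup A j) (lookup B i) (lookup B j) (w-nonneg i j)

  d-reversed : ∀ X → d G X ≡ Σ² (λ i j → cutTerm (lookup X j) (lookup X i) (w i j))
  d-reversed X = trans (∑-comm (λ i j → cutTerm (lookup X i) (lookup X j) (w i j)))
    (sum-cong-≗ (λ i → sum-cong-≗ (λ j → cong (cutTerm (lookup X j) (lookup X i)) (w-sym j i))))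

  d-posimodular : ∀ A B → d G (A ─ B) + d G (B ─ A) ≤ d G A + d G B
  d-posimodular A B rewrite d-reversed B | d-reversed (B ─ A) = Σ²-+-mono-≤ pointwise
    where
    pointwise : ∀ i j →
      cutTerm (lookup (A ─ B) i) (lookup (A ─ B) j) (w i j) + cutTerm (lookup (B ─ A) j) (lookup (B ─ A) i) (w i j)
        ≤ cutTerm (lookup A i) (lookup A j) (w i j) + cutTerm (lookup B j) (lookup B i) (w i j)
    pointwise i j rewrite lookup-─ A B i | lookup-─ A B j | lookup-─ B A i | lookup-─ B A j =
      cutTerm-posimodular (lookup A i) (lookup A j) (lookup B i) (lookup B j) (w-nonneg i j)

SteinerCut-⊆ : ∀ {n} {T X Y : Subset n} → SteinerCut T X → Y ⊆ X → Nonempty (Y ∩ T) → SteinerCut T Y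
SteinerCut-⊆ (_ , T⊈X) Y⊆X Y∩T≢∅ = Y∩T≢∅ , λ T⊆Y → T⊈X (λ x∈T → Y⊆X (T⊆Y x∈T))

terminal-in-difference : ∀ {n} {T X Y : Subset n} →
  Nonempty (X ∩ T) → ¬ Nonempty ((X ∩ Y) ∩ T) → Nonempty ((X ─ Y) ∩ T)
terminal-in-difference {X = X} {Y} (t , t∈X∩T) X∩Y∩T≡∅ =
  t , x∈p∩q⁺ (x∈p∧x∉q⇒x∈p─q t∈X (λ t∈Y → X∩Y∩T≡∅ (t , ∈-∩³ t∈X t∈Y t∈T)) , t∈T)
  where
  t∈X = proj₁ (x∈p∩q⁻ X _ t∈X∩T)
  t∈T = proj₂ (x∈p∩q⁻ X _ t∈X∩T)

module ExtremeSets {n} (G : WGraph n) (T : Subset n) where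

  extreme-─-< : ∀ {X Y} → Extreme G T X → Nonempty (X ∩ Y) → Nonempty ((X ─ Y) ∩ T) → d G X < d G (X ─ Y)
  extreme-─-< {X} {Y} (scX , minX) X∩Y≢∅ X─Y∩T≢∅ =
    minX (X ─ Y) (p∩q≢∅⇒p─q⊂p X Y X∩Y≢∅) (SteinerCut-⊆ scX (p─q⊆p X Y) X─Y∩T≢∅)

  extreme-∪-< : ∀ {A Z} → Extreme G T A → Nonempty ((Z ∩ A) ∩ T) → Nonempty (A ─ Z) → d G (Z ∪ A) < d G Z
  extreme-∪-< {A} {Z} (scA , minA) Z∩A∩T≢∅ (x , x∈A─Z) =
    +-≤-cancel-< (minA (Z ∩ A) Z∩A⊂A (SteinerCut-⊆ scA (p∩q⊆q Z A) Z∩A∩T≢∅)) (d-submodular G Z A)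
    where
    Z∩A⊂A : Z ∩ A ⊂ A
    Z∩A⊂A = p∩q⊆q Z A , x , p─q⊆p A Z x∈A─Z ,
            λ x∈Z∩A → x∈p─q⇒x∉q A Z x∈A─Z (proj₁ (x∈p∩q⁻ Z A x∈Z∩A))

  extreme-∪-≤ : ∀ {A Z} → Extreme G T A → Nonempty ((Z ∩ A) ∩ T) → d G (Z ∪ A) ≤ d G Z
  extreme-∪-≤ {A} {Z} exA Z∩A∩T≢∅ with nonempty? (A ─ Z)
  ... | yes A⊈Z   = <⇒≤ (extreme-∪-< exA Z∩A∩T≢∅ A⊈Z)
  ... | no  A─Z≡∅ = ≤-reflexive (cong (d G) (⊆-antisym (∪-least (λ x∈Z → x∈Z) (p─q≡∅⇒p⊆q A─Z≡∅)) (p⊆p∪q A)))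

  overlapping-extremes-share-terminal : ∀ {X Y} → Extreme G T X → Extreme G T Y →
    Nonempty (X ∩ Y) → Nonempty ((X ∩ Y) ∩ T)
  overlapping-extremes-share-terminal {X} {Y} exX exY X∩Y≢∅ with nonempty? ((X ∩ Y) ∩ T)
  ... | yes X∩Y∩T≢∅ = X∩Y∩T≢∅
  ... | no  X∩Y∩T≡∅ = ⊥-elim (<-irrefl refl (<-≤-trans (+-mono-< dX<dX─Y dY<dY─X) (d-posimodular G X Y)))
    where
    dX<dX─Y : d G X < d G (X ─ Y)
    dX<dX─Y = extreme-─-< exX X∩Y≢∅ (terminal-in-difference (proj₁ (proj₁ exX)) X∩Y∩T≡∅)
    dY<dY─X : d G Y < d G (Y ─ X)
    dY<dY─X = extreme-─-< exY (subst Nonempty (∩-comm X Y) X∩Y≢∅)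
      (terminal-in-difference (proj₁ (proj₁ exY)) (λ Y∩X∩T≢∅ → X∩Y∩T≡∅ (subst (λ S → Nonempty (S ∩ T)) (∩-comm Y X) Y∩X∩T≢∅)))

  union-below : ∀ {A B Z} → Extreme G T A → Extreme G T B → Nonempty ((A ∩ B) ∩ T) →
    Z ⊂ A ∪ B → Nonempty ((Z ∩ A) ∩ T) → d G (A ∪ B) < d G Z
  union-below {A} {B} {Z} exA exB (t , t∈A∩B∩T) (Z⊆A∪B , u , u∈A∪B , u∉Z) Z∩A∩T≢∅
    with ∈-∩³⁻ t∈A∩B∩T | nonempty? (A ─ Z)
  ... | t∈A , t∈B , t∈T | yes A⊈Z =
    ≤-<-trans (subst (λ S → d G S ≤ d G (Z ∪ A)) Z∪A∪B≡A∪B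
                     (extreme-∪-≤ exB (t , ∈-∩³ (q⊆p∪q Z A t∈A) t∈B t∈T)))
              (extreme-∪-< exA Z∩A∩T≢∅ A⊈Z)
    where
    Z∪A∪B≡A∪B : (Z ∪ A) ∪ B ≡ A ∪ B
    Z∪A∪B≡A∪B = ⊆-antisym (∪-least (∪-least Z⊆A∪B (p⊆p∪q B)) (q⊆p∪q A B))
                          (∪-least (λ x∈A → p⊆p∪q B (q⊆p∪q Z A x∈A)) (q⊆p∪q (Z ∪ A) B))
  ... | t∈A , t∈B , t∈T | no A─Z≡∅ =
    subst (λ S → d G S < d G Z) Z∪B≡A∪B
          (extreme-∪-< exB (t , ∈-∩³ (A⊆Z t∈A) t∈B t∈T) (u , x∈p∧x∉q⇒x∈p─q u∈B u∉Z))
    where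
    A⊆Z : A ⊆ Z
    A⊆Z = p─q≡∅⇒p⊆q A─Z≡∅
    u∈B : u ∈ B
    u∈B = [ (λ u∈A → ⊥-elim (u∉Z (A⊆Z u∈A))) , (λ u∈B → u∈B) ] (x∈p∪q⁻ A B u∈A∪B)
    Z∪B≡A∪B : Z ∪ B ≡ A ∪ B
    Z∪B≡A∪B = ⊆-antisym (∪-least Z⊆A∪B (q⊆p∪q A B)) (∪-least (λ x∈A → p⊆p∪q B (A⊆Z x∈A)) (q⊆p∪q Z B))

mainTheorem4 : (n : ℕ) (G : WGraph n) (T X Y : Subset n) →
    Extreme G T X → Extreme G T Y → Cross X Y → SteinerCut T (X ∪ Y) →
    Extreme G T (X ∪ Y)
mainTheorem4 n G T X Y exX exY (X∩Y≢∅ , _ , _) scX∪Y = scX∪Y , below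
  where
  open ExtremeSets G T
  shared : Nonempty ((X ∩ Y) ∩ T)
  shared = overlapping-extremes-share-terminal exX exY X∩Y≢∅
  below : ∀ Z → Z ⊂ X ∪ Y → SteinerCut T Z → d G (X ∪ Y) < d G Z
  below Z Z⊂X∪Y ((z , z∈Z∩T) , _) with x∈p∩q⁻ Z T z∈Z∩T
  ... | z∈Z , z∈T with x∈p∪q⁻ X Y (proj₁ Z⊂X∪Y z∈Z)
  ... | inj₁ z∈X = union-below exX exY shared Z⊂X∪Y (z , ∈-∩³ z∈Z z∈X z∈T)
  ... | inj₂ z∈Y = subst (λ S → d G S < d G Z) (∪-comm Y X)
    (union-below exY exX (subst (λ S → Nonempty (S ∩ T)) (∩-comm X Y) shared)
                 (subst (Z ⊂_) (∪-comm X Y) Z⊂X∪Y) (z , ∈-∩³ z∈Z z∈Y z∈T))
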